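{- For every finite simple graph $G$ on $n$ vertices and every finite field $\mathbb{F}$ of size $q$, \[\mathrm{minrk}_{\mathbb{F}}(G)\le\overline{\xi}_l(\overline{G},\mathbb{F})+\lceil\log_q n\rceil.\]
   Context: $\overline{G}$ is the complement of $G$. For a graph $G'$ on vertex set $\{1,\dots,n\}$, a matrix $M\in\mathbb{F}^{n\times n}$ represents $G'$ if $M_{i,i}\ne0$ for all $i$ and $M_{i,j}=0$ for all distinct non-adjacent $i,j$; $\mathrm{minrk}_{\mathbb{F}}(G')$ is the minimum rank over $\mathbb{F}$ of a matrix representing $G'$. For $x,y\in\mathbb{F}^s$ let $\langle x,y\rangle=\sum_i x_iy_i$. An orthogonal representation of a graph $G'=(V,E)$ over $\mathbb{F}$ assigns a vector $u_v\in\mathbb{F}^s$ (for some $s$) to each vertex with $\langle u_v,u_v\rangle\ne0$ for all $v$ and $\langle u_v,u_{v'}\rangle=0$ whenever $v,v'$ are adjacent. Its locality is $\max_v\dim\mathrm{span}\{u_{v'}:v'\in\{v\}\cup N(v)\}$, where $N(v)$ is the set of neighbors of $v$. The local orthogonality dimension $\overline{\xi}_l(G',\mathbb{F})$ is the smallest locality of an orthogonal representation of $G'$ over $\mathbb{F}$. -}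

module Defs where

open import Level using (Level; _⊔_)
open import Algebra.Bundles using (CommutativeRing)
open import Data.Nat using (ℕ; _≤_; _^_)
open import Data.Fin using (Fin)
open import Data.Product using (Σ; ∃; _×_; _,_; proj₁)
open import Data.Sum using (_⊎_)
open import Relation.Nullary using (¬_; Dec)
open import Relation.Binary.PropositionalEquality using (_≡_; _≢_)
import Algebra.Definitions.RawMonoid as RawMonoidDefs

record Field (c ℓ : Level) : Set (Level.suc (c ⊔ ℓ)) where
  field
    commutativeRing : CommutativeRing c ℓ
  open CommutativeRing commutativeRing public
  field
    0≉1     : ¬ (0# ≈ 1#)
    inverse : ∀ x → ¬ (x ≈ 0#) → Σ Carrier λ y → (x * y) ≈ 1#

record HasSize {c ℓ : Level} (F : Field c ℓ) (q : ℕ) : Set (c ⊔ ℓ) where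
  open Field F
  field
    enum       : Fin q → Carrier
    injective  : ∀ i j → enum i ≈ enum j → i ≡ j
    surjective : ∀ x → Σ (Fin q) λ i → x ≈ enum i

record Graph (n : ℕ) : Set₁ where
  field
    Adj      : Fin n → Fin n → Set
    adj?     : ∀ i j → Dec (Adj i j)
    symmetric : ∀ {i j} → Adj i j → Adj j i
    irreflexive : ∀ {i} → ¬ Adj i i

complement : ∀ {n} → Graph n → Graph n
complement {n} G = record
  { Adj = λ i j → (i ≢ j) × ¬ Adj i j
  ; adj? = dec
  ; symmetric = λ { (i≢j , ¬a) → (λ e → i≢j (sym′ e)) , (λ a → ¬a (symmetric a)) }
  ; irreflexive = λ { (i≢i , _) → i≢i refl′ }
  }
  where
  open Graph G
  open import Data.Fin using (_≟_)
  open import Relation.Nullary using (yes; no)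
  open import Relation.Binary.PropositionalEquality using (sym; refl)
  sym′ : ∀ {i j : Fin n} → i ≡ j → j ≡ i
  sym′ = sym
  refl′ : ∀ {i : Fin n} → i ≡ i
  refl′ = refl
  dec : ∀ i j → Dec ((i ≢ j) × ¬ Adj i j)
  dec i j with i ≟ j | adj? i j
  ... | yes e | _     = no λ { (ne , _) → ne e }
  ... | no ne | yes a = no λ { (_ , na) → na a }
  ... | no ne | no na = yes (ne , na)

module LinAlg {c ℓ : Level} (F : Field c ℓ) where
  open Field F
  open RawMonoidDefs +-rawMonoid using (sum)

  Vec : ℕ → Set c
  Vec s = Fin s → Carrier

  ⟨_,_⟩ : ∀ {s} → Vec s → Vec s → Carrier
  ⟨ x , y ⟩ = sum λ i → x i * y i

  lincomb : ∀ {s m} → (Fin m → Carrier) → (Fin m → Vec s) → Vec s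
  lincomb cs w k = sum λ j → cs j * w j k

  LinIndep : ∀ {s m} → (Fin m → Vec s) → Set (c ⊔ ℓ)
  LinIndep {s} {m} w =
    ∀ (cs : Fin m → Carrier) → (∀ k → lincomb cs w k ≈ 0#) → ∀ j → cs j ≈ 0#

  -- dim span{ w_i : i ∈ I } ≤ d, for a family of vectors indexed by a
  -- type I: every linearly independent list of members of the family
  -- has length at most d (dimension = maximal size of an independent set).
  DimSpan≤ : ∀ {a} {I : Set a} {s} → (I → Vec s) → ℕ → Set (a ⊔ c ⊔ ℓ)
  DimSpan≤ {I = I} w d =
    ∀ (m : ℕ) (idx : Fin m → I) → LinIndep (λ j → w (idx j)) → m ≤ d

  Matrix : ℕ → Set c
  Matrix n = Fin n → Fin n → Carrier

  Rank≤ : ∀ {n} → Matrix n → ℕ → Set (c ⊔ ℓ)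
  Rank≤ M r = DimSpan≤ (λ j i → M i j) r

  Represents : ∀ {n} → Graph n → Matrix n → Set ℓ
  Represents {n} G M =
    (∀ i → ¬ (M i i ≈ 0#)) ×
    (∀ i j → i ≢ j → ¬ Graph.Adj G i j → M i j ≈ 0#)

  Minrk≤ : ∀ {n} → Graph n → ℕ → Set (c ⊔ ℓ)
  Minrk≤ G r = ∃ λ M → Represents G M × Rank≤ M r

  IsOrthRep : ∀ {n s} → Graph n → (Fin n → Vec s) → Set ℓ
  IsOrthRep G u =
    (∀ v → ¬ (⟨ u v , u v ⟩ ≈ 0#)) ×
    (∀ v v′ → Graph.Adj G v v′ → ⟨ u v , u v′ ⟩ ≈ 0#)

  Locality≤ : ∀ {n s} → Graph n → (Fin n → Vec s) → ℕ → Set (c ⊔ ℓ)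
  Locality≤ {n} G u t =
    ∀ v → DimSpan≤ {I = Σ (Fin n) λ v′ → (v′ ≡ v) ⊎ Graph.Adj G v v′}
                   (λ p → u (proj₁ p)) t

  LocOrthDim≤ : ∀ {n} → Graph n → ℕ → Set (c ⊔ ℓ)
  LocOrthDim≤ {n} G t =
    Σ ℕ λ s → Σ (Fin n → Vec s) λ u → IsOrthRep G u × Locality≤ G u t

IsCeilLog : ℕ → ℕ → ℕ → Set
IsCeilLog q n k = (n ≤ q ^ k) × (∀ j → n ≤ q ^ j → k ≤ j)

{-# OPTIONS --safe #-}

-- Take an orthogonal representation u of the complement of G in F^s of locality t, and put
-- g = u: the matrix M i j = ⟨ g i , u j ⟩ represents G and has rank ≤ s. While s > t + ⌈log_q n⌉, the
-- spans of u over the closed neighbourhoods N[i] in the complement have dimension ≤ t, so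
-- together they contain at most n·q^t < q^s vectors, and some x lies in none of them. Replace
-- each g i by a functional that vanishes on x and agrees with g i on the span of N[i], and pass
-- to F^s/⟨x⟩ ≅ F^(s-1): the entries of M that matter and the locality survive, and s drops by one.

module Submission where

open import Defs
open import Level using (Level)
open import Data.Nat as ℕ using (ℕ; zero; suc; z≤n; s≤s)
import Data.Nat.Properties as ℕ
open import Data.Fin as Fin using (Fin; zero; suc; punchIn; punchOut; finToFun; funToFin)
import Data.Fin.Properties as Fin
open import Data.Product using (Σ; ∃; ∃₂; _×_; _,_; proj₁; proj₂)
open import Data.Sum using (_⊎_; inj₁; inj₂)
open import Data.Empty using (⊥-elim)
open import Function using (_∘_)
open import Relation.Nullary using (¬_; Dec; yes; no; contradiction; _⊎-dec_)
open import Relation.Binary.Definitions using (Decidable)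
open import Relation.Binary.PropositionalEquality as ≡ using (_≡_; _≢_)
open import Data.Vec.Functional using (_∷_; insertAt)
open import Data.Vec.Functional.Properties using (insertAt-lookup; insertAt-punchIn)

distinct⇒2≤ : ∀ {m} {i j : Fin m} → i ≢ j → 2 ℕ.≤ m
distinct⇒2≤ {suc zero}    {zero} {zero} i≢j = contradiction ≡.refl i≢j
distinct⇒2≤ {suc (suc _)} _                 = s≤s (s≤s z≤n)

n*q^t<q^[1+s] : ∀ {q n t k s} → 2 ℕ.≤ q → n ℕ.≤ q ℕ.^ k → t ℕ.+ k ℕ.≤ s → n ℕ.* q ℕ.^ t ℕ.< q ℕ.^ suc s
n*q^t<q^[1+s] {suc zero} (s≤s ()) _ _
n*q^t<q^[1+s] {q@(suc (suc _))} {n} {t} {k} {s} 2≤q n≤q^k t+k≤s = begin-strict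
  n * q ^ t     ≤⟨ *-monoˡ-≤ (q ^ t) n≤q^k ⟩
  q ^ k * q ^ t ≡⟨ ^-distribˡ-+-* q k t ⟨
  q ^ (k + t)   ≤⟨ ^-monoʳ-≤ q (≡.subst (ℕ._≤ s) (+-comm t k) t+k≤s) ⟩
  q ^ s         <⟨ m<m*n (q ^ s) q {{m^n≢0 q s}} 2≤q ⟩
  q ^ s * q     ≡⟨ *-comm (q ^ s) q ⟩
  q * q ^ s     ∎
  where
  open import Data.Nat.Base using (_+_; _*_; _^_)
  open import Data.Nat.Properties
  open ≤-Reasoning

funToFin-cong : ∀ {m n} {f g : Fin m → Fin n} → (∀ i → f i ≡ g i) → funToFin f ≡ funToFin g
funToFin-cong {zero}  _   = ≡.refl
funToFin-cong {suc m} f≗g = ≡.cong₂ Fin.combine (f≗g zero) (funToFin-cong (f≗g ∘ suc))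

shift : ∀ {m r} {P : Fin (suc m) → Set} → (Fin r → Σ (Fin m) (P ∘ suc)) → Fin r → Σ (Fin (suc m)) P
shift idx l = suc (proj₁ (idx l)) , proj₂ (idx l)

module LinearAlgebra {c ℓ : Level} (F : Field c ℓ) (_≟_ : Decidable (Field._≈_ F)) where
  open Field F hiding (zero)
  open LinAlg F
  open import Algebra.Properties.Semiring.Sum semiring
    using (sum; sum-cong-≋; sum-replicate-zero; sum-remove; ∑-distrib-+; ∑-comm; *-distribˡ-sum; *-distribʳ-sum)
  open import Algebra.Properties.Group +-group
    using (inverseʳ-unique; x∙y⁻¹≈ε⇒x≈y; //-rightDividesˡ; ⁻¹-involutive)
  open import Algebra.Properties.Ring ring using (-1*x≈-x; -‿distribˡ-*; -‿distribʳ-*; x[y-z]≈xy-xz; [y-z]x≈yx-zx)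
  open import Algebra.Properties.CommutativeSemigroup *-commutativeSemigroup using (x∙yz≈y∙xz)
  open import Data.Vec.Functional.Relation.Binary.Equality.Setoid setoid using (_≋_)
  open import Relation.Binary.Reasoning.Setoid setoid

  inv : ∀ x → x ≉ 0# → Carrier
  inv x x≉0 = proj₁ (inverse x x≉0)

  inv-cancelʳ : ∀ y {x} (x≉0 : x ≉ 0#) → y * inv x x≉0 * x ≈ y
  inv-cancelʳ y {x} x≉0 = begin
    y * inv x x≉0 * x   ≈⟨ *-assoc y _ x ⟩
    y * (inv x x≉0 * x) ≈⟨ *-congˡ (trans (*-comm _ x) (proj₂ (inverse x x≉0))) ⟩
    y * 1#              ≈⟨ *-identityʳ y ⟩
    y                   ∎

  sum-≈0 : ∀ {m} (f : Fin m → Carrier) → (∀ i → f i ≈ 0#) → sum f ≈ 0#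
  sum-≈0 {m} f f≈0 = trans (sum-cong-≋ f≈0) (sum-replicate-zero m)

  sum-neg : ∀ {m} (f : Fin m → Carrier) → sum (λ i → - f i) ≈ - sum f
  sum-neg f = begin
    sum (λ i → - f i)      ≈⟨ sum-cong-≋ (λ i → sym (-1*x≈-x (f i))) ⟩
    sum (λ i → - 1# * f i) ≈⟨ *-distribˡ-sum (- 1#) f ⟨
    - 1# * sum f           ≈⟨ -1*x≈-x (sum f) ⟩
    - sum f                ∎

  ∑-distrib-- : ∀ {m} (f g : Fin m → Carrier) → sum (λ i → f i - g i) ≈ sum f - sum g
  ∑-distrib-- f g = trans (∑-distrib-+ f (λ i → - g i)) (+-congˡ (sum-neg g))

  ∑-*-sub : ∀ {m} (cs a b : Fin m → Carrier) e →
    sum (λ j → cs j * (a j - b j * e)) ≈ sum (λ j → cs j * a j) - sum (λ j → cs j * b j) * e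
  ∑-*-sub cs a b e = begin
    sum (λ j → cs j * (a j - b j * e))
      ≈⟨ sum-cong-≋ (λ j → trans (x[y-z]≈xy-xz (cs j) _ _) (+-congˡ (-‿cong (sym (*-assoc _ _ _))))) ⟩
    sum (λ j → cs j * a j - cs j * b j * e)      ≈⟨ ∑-distrib-- _ (λ j → cs j * b j * e) ⟩
    sum (λ j → cs j * a j) - sum (λ j → cs j * b j * e) ≈⟨ +-congˡ (-‿cong (*-distribʳ-sum e (λ j → cs j * b j))) ⟨
    sum (λ j → cs j * a j) - sum (λ j → cs j * b j) * e ∎

  δ : ∀ {m} → Fin m → Fin m → Carrier
  δ p i with i Fin.≟ p
  ... | yes _ = 1#
  ... | no _  = 0#

  δ-diag : ∀ {m} (p : Fin m) → δ p p ≈ 1#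
  δ-diag p with p Fin.≟ p
  ... | yes _  = refl
  ... | no p≢p = contradiction ≡.refl p≢p

  sum-δ : ∀ {m} (p : Fin m) (f : Fin m → Carrier) → sum (λ i → δ p i * f i) ≈ f p
  sum-δ {suc m} p f = begin
    sum (λ i → δ p i * f i)                              ≈⟨ sum-remove {i = p} (λ i → δ p i * f i) ⟩
    δ p p * f p + sum (λ l → δ p (punchIn p l) * f (punchIn p l))
      ≈⟨ +-cong (trans (*-congʳ (δ-diag p)) (*-identityˡ (f p))) (sum-≈0 _ (λ l → trans (*-congʳ (δ-off l)) (zeroˡ _))) ⟩
    f p + 0#                                             ≈⟨ +-identityʳ (f p) ⟩
    f p                                                  ∎
    where
    δ-off : ∀ l → δ p (punchIn p l) ≈ 0#
    δ-off l with punchIn p l Fin.≟ p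
    ... | yes eq = contradiction eq (Fin.punchInᵢ≢i p l)
    ... | no _   = refl

  0ᵛ : ∀ {s} → Vec s
  0ᵛ _ = 0#

  _·_ : ∀ {s} → Carrier → Vec s → Vec s
  (a · x) k = a * x k

  _≋?_ : ∀ {s} → Decidable (_≋_ {n = s})
  x ≋? y = Fin.all? (λ k → x k ≟ y k)

  nonzero-coordinate : ∀ {s} (x : Vec s) → ¬ (x ≋ 0ᵛ) → ∃ λ p → x p ≉ 0#
  nonzero-coordinate x = Fin.¬∀⟶∃¬ _ _ (λ k → x k ≟ 0#)

  zero-or-nonzero : ∀ {s m} (y : Fin m → Vec s) → (∀ j → y j ≋ 0ᵛ) ⊎ ∃₂ λ j p → y j p ≉ 0#
  zero-or-nonzero y with Fin.all? (λ j → y j ≋? 0ᵛ)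
  ... | yes y≋0 = inj₁ y≋0
  ... | no y≉0 with Fin.¬∀⟶∃¬ _ _ (λ j → y j ≋? 0ᵛ) y≉0
  ... | j , yⱼ≉0 = inj₂ (j , nonzero-coordinate (y j) yⱼ≉0)

  ⟨⟩-congˡ : ∀ {s} {g g′ : Vec s} (y : Vec s) → g ≋ g′ → ⟨ g , y ⟩ ≈ ⟨ g′ , y ⟩
  ⟨⟩-congˡ y g≋g′ = sum-cong-≋ (λ k → *-congʳ (g≋g′ k))

  ⟨⟩-congʳ : ∀ {s} (g : Vec s) {y y′ : Vec s} → y ≋ y′ → ⟨ g , y ⟩ ≈ ⟨ g , y′ ⟩
  ⟨⟩-congʳ g y≋y′ = sum-cong-≋ (λ k → *-congˡ (y≋y′ k))

  ⟨⟩-zeroˡ : ∀ {s} (y : Vec s) → ⟨ 0ᵛ , y ⟩ ≈ 0#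
  ⟨⟩-zeroˡ y = sum-≈0 _ (λ k → zeroˡ (y k))

  ⟨⟩-zeroʳ : ∀ {s} (g : Vec s) → ⟨ g , 0ᵛ ⟩ ≈ 0#
  ⟨⟩-zeroʳ g = sum-≈0 _ (λ k → zeroʳ (g k))

  ⟨⟩-lincombʳ : ∀ {s m} (g : Vec s) (cs : Fin m → Carrier) (w : Fin m → Vec s) →
                ⟨ g , lincomb cs w ⟩ ≈ sum (λ j → cs j * ⟨ g , w j ⟩)
  ⟨⟩-lincombʳ g cs w = begin
    sum (λ k → g k * sum (λ j → cs j * w j k))   ≈⟨ sum-cong-≋ (λ k → *-distribˡ-sum (g k) (λ j → cs j * w j k)) ⟩
    sum (λ k → sum (λ j → g k * (cs j * w j k))) ≈⟨ ∑-comm (λ k j → g k * (cs j * w j k)) ⟩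
    sum (λ j → sum (λ k → g k * (cs j * w j k)))
      ≈⟨ sum-cong-≋ (λ j → sum-cong-≋ (λ k → x∙yz≈y∙xz (g k) (cs j) (w j k))) ⟩
    sum (λ j → sum (λ k → cs j * (g k * w j k))) ≈⟨ sum-cong-≋ (λ j → *-distribˡ-sum (cs j) (λ k → g k * w j k)) ⟨
    sum (λ j → cs j * ⟨ g , w j ⟩)               ∎

  lincomb-δ : ∀ {s m} (p : Fin m) (w : Fin m → Vec s) → lincomb (δ p) w ≋ w p
  lincomb-δ p w k = sum-δ p (λ j → w j k)

  lincomb-*ˡ : ∀ {s m} a (cs : Fin m → Carrier) (w : Fin m → Vec s) → lincomb (λ j → a * cs j) w ≋ a · lincomb cs w
  lincomb-*ˡ a cs w k = trans (sum-cong-≋ (λ j → *-assoc a (cs j) (w j k))) (sym (*-distribˡ-sum a (λ j → cs j * w j k)))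

  lincomb-congˡ : ∀ {s m} {cs cs′ : Fin m → Carrier} (w : Fin m → Vec s) → cs ≋ cs′ → lincomb cs w ≋ lincomb cs′ w
  lincomb-congˡ w cs≋cs′ k = sum-cong-≋ (λ j → *-congʳ (cs≋cs′ j))

  lincomb-tail : ∀ {s m} (x : Vec s) (w : Fin m → Vec s) cs → cs zero ≈ 0# → lincomb cs (x ∷ w) ≋ lincomb (cs ∘ suc) w
  lincomb-tail x w cs c₀≈0 k = trans (+-congʳ (trans (*-congʳ c₀≈0) (zeroˡ (x k)))) (+-identityˡ _)

  InSpan : ∀ {s m} → (Fin m → Vec s) → Vec s → Set (c Level.⊔ ℓ)
  InSpan w x = ∃ λ cs → lincomb cs w ≋ x

  InSpan-zero : ∀ {s m} (w : Fin m → Vec s) {y} → y ≋ 0ᵛ → InSpan w y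
  InSpan-zero w y≋0 = (λ _ → 0#) , λ k → trans (sum-≈0 (λ j → 0# * w j k) (λ j → zeroˡ (w j k))) (sym (y≋0 k))

  InSpan-∈ : ∀ {s m} (w : Fin m → Vec s) p → InSpan w (w p)
  InSpan-∈ w p = δ p , lincomb-δ p w


  InSpan-∷ : ∀ {s m} (x : Vec s) (w : Fin m → Vec s) {y} → InSpan w y → InSpan (x ∷ w) y
  InSpan-∷ x w (cs , cs·w≋y) = (0# ∷ cs) , λ k → trans (lincomb-tail x w (0# ∷ cs) refl k) (cs·w≋y k)

  InSpan-pad : ∀ {s r t} → r ℕ.≤ t → (B : Fin r → Vec s) →
               ∃ λ (B′ : Fin t → Vec s) → ∀ {y} → InSpan B y → InSpan B′ y
  InSpan-pad z≤n B = (λ _ → 0ᵛ) , λ { (cs , cs·B≋y) → InSpan-zero (λ _ → 0ᵛ) (λ k → sym (cs·B≋y k)) }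
  InSpan-pad (s≤s r≤t) B with InSpan-pad r≤t (B ∘ suc)
  ... | B′ , B⊆B′ = (B zero ∷ B′) , λ { (cs , cs·B≋y) →
    let cs′ , cs′·B′≋ = B⊆B′ (cs ∘ suc , λ _ → refl)
    in (cs zero ∷ cs′) , λ k → trans (+-congˡ (cs′·B′≋ k)) (cs·B≋y k) }

  LinIndep-nonzero : ∀ {s m} (w : Fin m → Vec s) → LinIndep w → ∀ j → ¬ (w j ≋ 0ᵛ)
  LinIndep-nonzero w ind j wⱼ≋0 =
    0≉1 (sym (trans (sym (δ-diag j)) (ind (δ j) (λ k → trans (lincomb-δ j w k) (wⱼ≋0 k)) j)))

  dependent⇒InSpan : ∀ {s m} (w : Fin (suc m) → Vec s) cs → lincomb cs w ≋ 0ᵛ → cs zero ≉ 0# →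
                     InSpan (w ∘ suc) (w zero)
  dependent⇒InSpan w cs cs·w≋0 c₀≉0 = (λ l → - i * cs (suc l)) , λ k → begin
    lincomb (λ l → - i * cs (suc l)) (w ∘ suc) k ≈⟨ lincomb-*ˡ (- i) (cs ∘ suc) (w ∘ suc) k ⟩
    - i * lincomb (cs ∘ suc) (w ∘ suc) k         ≈⟨ *-congˡ (inverseʳ-unique _ _ (cs·w≋0 k)) ⟩
    - i * - (cs zero * w zero k)                 ≈⟨ -‿distribˡ-* i _ ⟨
    - (i * - (cs zero * w zero k))               ≈⟨ -‿cong (-‿distribʳ-* i _) ⟨
    - - (i * (cs zero * w zero k))               ≈⟨ ⁻¹-involutive _ ⟩
    i * (cs zero * w zero k)                     ≈⟨ x∙yz≈y∙xz i (cs zero) (w zero k) ⟩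
    cs zero * (i * w zero k)                     ≈⟨ *-assoc _ i _ ⟨
    cs zero * i * w zero k                       ≈⟨ *-congʳ (proj₂ (inverse (cs zero) c₀≉0)) ⟩
    1# * w zero k                                ≈⟨ *-identityˡ _ ⟩
    w zero k                                     ∎
    where i = inv (cs zero) c₀≉0

  LinIndep-∷ : ∀ {s m} {x : Vec s} {w : Fin m → Vec s} → LinIndep w → ¬ InSpan w x → LinIndep (x ∷ w)
  LinIndep-∷ {x = x} {w} ind x∉w cs cs·w≋0 with cs zero ≟ 0#
  ... | no c₀≉0  = ⊥-elim (x∉w (dependent⇒InSpan (x ∷ w) cs cs·w≋0 c₀≉0))
  ... | yes c₀≈0 = λ { zero → c₀≈0 ; (suc j) → ind (cs ∘ suc) tail≋0 j }
    where
    tail≋0 : lincomb (cs ∘ suc) w ≋ 0ᵛ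
    tail≋0 k = trans (sym (lincomb-tail x w cs c₀≈0 k)) (cs·w≋0 k)

  -- delete is the quotient map F^(1+s) → F^(1+s)/⟨x⟩ ≅ F^s: subtract the multiple of x that
  -- clears coordinate p, then drop that coordinate.
  module Deletion {s} (x : Vec (suc s)) (p : Fin (suc s)) (xₚ≉0 : x p ≉ 0#) where

    coeff : Vec (suc s) → Carrier
    coeff y = y p * inv (x p) xₚ≉0

    delete : Vec (suc s) → Vec s
    delete y l = y (punchIn p l) - coeff y * x (punchIn p l)

    coeff-lincomb : ∀ {m} cs (w : Fin m → Vec (suc s)) → coeff (lincomb cs w) ≈ sum (λ j → cs j * coeff (w j))
    coeff-lincomb cs w = trans (*-distribʳ-sum _ (λ j → cs j * w j p)) (sum-cong-≋ (λ j → *-assoc (cs j) _ _))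

    delete-lincomb : ∀ {m} cs (w : Fin m → Vec (suc s)) → delete (lincomb cs w) ≋ lincomb cs (delete ∘ w)
    delete-lincomb cs w l = begin
      lincomb cs w (punchIn p l) - coeff (lincomb cs w) * x (punchIn p l)
        ≈⟨ +-congˡ (-‿cong (*-congʳ (coeff-lincomb cs w))) ⟩
      lincomb cs w (punchIn p l) - sum (λ j → cs j * coeff (w j)) * x (punchIn p l)
        ≈⟨ ∑-*-sub cs (λ j → w j (punchIn p l)) (coeff ∘ w) (x (punchIn p l)) ⟨
      lincomb cs (delete ∘ w) l ∎

    delete-0 : ∀ {y} → y ≋ 0ᵛ → delete y ≋ 0ᵛ
    delete-0 y≋0 l = trans (+-cong (y≋0 _) (-‿cong (trans (*-congʳ (trans (*-congʳ (y≋0 p)) (zeroˡ _))) (zeroˡ _))))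
                           (-‿inverseʳ 0#)

    delete-kernel : ∀ {y} → delete y ≋ 0ᵛ → y ≋ coeff y · x
    delete-kernel {y} del≋0 k with k Fin.≟ p
    ... | yes ≡.refl = sym (inv-cancelʳ (y p) xₚ≉0)
    ... | no k≢p = ≡.subst (λ i → y i ≈ coeff y * x i) (Fin.punchIn-punchOut p≢k)
                           (x∙y⁻¹≈ε⇒x≈y _ _ (del≋0 (punchOut p≢k)))
      where p≢k = k≢p ∘ ≡.sym

    ⟨⟩-delete : ∀ g y → ⟨ g , y ⟩ ≈ ⟨ g ∘ punchIn p , delete y ⟩ + coeff y * ⟨ g , x ⟩
    ⟨⟩-delete g y = begin
      ⟨ g , y ⟩                               ≈⟨ trans (sum-remove {i = p} (λ k → g k * y k)) (+-comm _ _) ⟩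
      Sy + g p * y p                          ≈⟨ +-congʳ (//-rightDividesˡ (Sx * μ) Sy) ⟨
      Sy - Sx * μ + Sx * μ + g p * y p        ≈⟨ +-assoc _ _ _ ⟩
      Sy - Sx * μ + (Sx * μ + g p * y p)      ≈⟨ +-cong deleted correction ⟩
      ⟨ g ∘ punchIn p , delete y ⟩ + μ * ⟨ g , x ⟩ ∎
      where
      μ  = coeff y
      Sy = sum (λ l → g (punchIn p l) * y (punchIn p l))
      Sx = sum (λ l → g (punchIn p l) * x (punchIn p l))
      deleted : Sy - Sx * μ ≈ ⟨ g ∘ punchIn p , delete y ⟩
      deleted = begin
        Sy - Sx * μ ≈⟨ ∑-*-sub (g ∘ punchIn p) (y ∘ punchIn p) (x ∘ punchIn p) μ ⟨
        sum (λ l → g (punchIn p l) * (y (punchIn p l) - x (punchIn p l) * μ))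
          ≈⟨ sum-cong-≋ (λ l → *-congˡ (+-congˡ (-‿cong (*-comm (x (punchIn p l)) μ)))) ⟩
        ⟨ g ∘ punchIn p , delete y ⟩ ∎
      correction : Sx * μ + g p * y p ≈ μ * ⟨ g , x ⟩
      correction = begin
        Sx * μ + g p * y p             ≈⟨ +-comm _ _ ⟩
        g p * y p + Sx * μ             ≈⟨ +-cong (*-congˡ (sym (inv-cancelʳ (y p) xₚ≉0))) (*-comm Sx μ) ⟩
        g p * (μ * x p) + μ * Sx       ≈⟨ +-congʳ (x∙yz≈y∙xz (g p) μ (x p)) ⟩
        μ * (g p * x p) + μ * Sx       ≈⟨ distribˡ μ _ _ ⟨
        μ * (g p * x p + Sx)           ≈⟨ *-congˡ (sum-remove {i = p} (λ k → g k * x k)) ⟨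
        μ * ⟨ g , x ⟩                  ∎

    extend : Vec s → Carrier → Vec (suc s)
    extend g β = insertAt g p ((β - ⟨ g , x ∘ punchIn p ⟩) * inv (x p) xₚ≉0)

    extend-punchIn : ∀ g β → extend g β ∘ punchIn p ≋ g
    extend-punchIn g β l = reflexive (insertAt-punchIn g p _ l)

    ⟨extend,x⟩ : ∀ g β → ⟨ extend g β , x ⟩ ≈ β
    ⟨extend,x⟩ g β = begin
      ⟨ extend g β , x ⟩ ≈⟨ sum-remove {i = p} (λ k → extend g β k * x k) ⟩
      extend g β p * x p + ⟨ extend g β ∘ punchIn p , x ∘ punchIn p ⟩
        ≈⟨ +-cong (*-congʳ (reflexive (insertAt-lookup g p _))) (⟨⟩-congˡ (x ∘ punchIn p) (extend-punchIn g β)) ⟩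
      (β - ⟨ g , x ∘ punchIn p ⟩) * inv (x p) xₚ≉0 * x p + ⟨ g , x ∘ punchIn p ⟩
        ≈⟨ +-congʳ (inv-cancelʳ _ xₚ≉0) ⟩
      β - ⟨ g , x ∘ punchIn p ⟩ + ⟨ g , x ∘ punchIn p ⟩ ≈⟨ //-rightDividesˡ _ β ⟩
      β ∎

    LinIndep-delete : ∀ {m} (w : Fin m → Vec (suc s)) → LinIndep (delete ∘ w) → LinIndep w
    LinIndep-delete w ind cs cs·w≋0 = ind cs (λ l → trans (sym (delete-lincomb cs w l)) (delete-0 cs·w≋0 l))

  LinIndep⇒≤ : ∀ {d m} (w : Fin m → Vec d) → LinIndep w → m ℕ.≤ d
  LinIndep⇒≤ {m = zero} w ind = z≤n
  LinIndep⇒≤ {zero} {suc m} w ind = ⊥-elim (LinIndep-nonzero w ind zero (λ ()))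
  LinIndep⇒≤ {suc d} {suc m} w ind with nonzero-coordinate (w zero) (LinIndep-nonzero w ind zero)
  ... | p , w₀ₚ≉0 = s≤s (LinIndep⇒≤ (delete ∘ w ∘ suc) ind′)
    where
    open Deletion (w zero) p w₀ₚ≉0
    ind′ : LinIndep (delete ∘ w ∘ suc)
    ind′ cs cs·w′≋0 = ind (- coeff v ∷ cs) combination≋0 ∘ suc
      where
      v = lincomb cs (w ∘ suc)
      v∈⟨w₀⟩ : v ≋ coeff v · w zero
      v∈⟨w₀⟩ = delete-kernel (λ l → trans (delete-lincomb cs (w ∘ suc) l) (cs·w′≋0 l))
      combination≋0 : lincomb (- coeff v ∷ cs) w ≋ 0ᵛ
      combination≋0 k = trans (+-cong (sym (-‿distribˡ-* (coeff v) (w zero k))) (v∈⟨w₀⟩ k)) (-‿inverseˡ _)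

  rank-gram≤ : ∀ {n s} (g u : Fin n → Vec s) → Rank≤ (λ i j → ⟨ g i , u j ⟩) s
  rank-gram≤ g u m idx ind = LinIndep⇒≤ (u ∘ idx) λ cs cs·u≋0 → ind cs λ i →
    trans (sym (⟨⟩-lincombʳ (g i) cs (u ∘ idx))) (trans (⟨⟩-congʳ (g i) cs·u≋0) (⟨⟩-zeroʳ (g i)))

  Consistent : ∀ {d m} → (Fin m → Vec d) → (Fin m → Carrier) → Set (c Level.⊔ ℓ)
  Consistent y b = ∀ cs → lincomb cs y ≋ 0ᵛ → sum (λ j → cs j * b j) ≈ 0#

  Solvable : ∀ {d m} → (Fin m → Vec d) → (Fin m → Carrier) → Set (c Level.⊔ ℓ)
  Solvable y b = ∃ λ g → ∀ j → ⟨ g , y j ⟩ ≈ b j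

  consistent-zero : ∀ {d m} {y : Fin m → Vec d} {b} → (∀ j → y j ≋ 0ᵛ) → Consistent y b → ∀ j → b j ≈ 0#
  consistent-zero {y = y} {b} y≋0 con j = trans (sym (sum-δ j b)) (con (δ j) (λ k → trans (lincomb-δ j y k) (y≋0 j k)))

  ∑-sub-δ : ∀ {m} (cs : Fin m → Carrier) μ j₀ f →
                sum (λ j → (cs j - μ * δ j₀ j) * f j) ≈ sum (λ j → cs j * f j) - μ * f j₀
  ∑-sub-δ cs μ j₀ f = begin
    sum (λ j → (cs j - μ * δ j₀ j) * f j)
      ≈⟨ sum-cong-≋ (λ j → trans ([y-z]x≈yx-zx (f j) _ _) (+-congˡ (-‿cong (*-assoc μ _ _)))) ⟩
    sum (λ j → cs j * f j - μ * (δ j₀ j * f j))             ≈⟨ ∑-distrib-- _ (λ j → μ * (δ j₀ j * f j)) ⟩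
    sum (λ j → cs j * f j) - sum (λ j → μ * (δ j₀ j * f j))
      ≈⟨ +-congˡ (-‿cong (*-distribˡ-sum μ (λ j → δ j₀ j * f j))) ⟨
    sum (λ j → cs j * f j) - μ * sum (λ j → δ j₀ j * f j)   ≈⟨ +-congˡ (-‿cong (*-congˡ (sum-δ j₀ f))) ⟩
    sum (λ j → cs j * f j) - μ * f j₀                       ∎

  -- One step of Gaussian elimination, pivoting on the nonzero entry p of y j₀.
  module Pivot {d m} (y : Fin m → Vec (suc d)) (b : Fin m → Carrier) (j₀ : Fin m) (p : Fin (suc d))
               (y₀ₚ≉0 : y j₀ p ≉ 0#) where
    open Deletion (y j₀) p y₀ₚ≉0 public

    reducedᵇ : Fin m → Carrier
    reducedᵇ j = b j - coeff (y j) * b j₀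

    reduce-consistent : Consistent y b → Consistent (delete ∘ y) reducedᵇ
    reduce-consistent con cs cs·y′≋0 = begin
      sum (λ j → cs j * (b j - coeff (y j) * b j₀))                  ≈⟨ ∑-*-sub cs b (coeff ∘ y) (b j₀) ⟩
      sum (λ j → cs j * b j) - sum (λ j → cs j * coeff (y j)) * b j₀ ≈⟨ +-congˡ (-‿cong (*-congʳ (coeff-lincomb cs y))) ⟨
      sum (λ j → cs j * b j) - μ * b j₀                              ≈⟨ ∑-sub-δ cs μ j₀ b ⟨
      sum (λ j → (cs j - μ * δ j₀ j) * b j)                          ≈⟨ con _ C·y≋0 ⟩
      0#                                                             ∎
      where
      μ = coeff (lincomb cs y)
      C·y≋0 : lincomb (λ j → cs j - μ * δ j₀ j) y ≋ 0ᵛ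
      C·y≋0 k = trans (∑-sub-δ cs μ j₀ (λ j → y j k))
        (trans (+-congʳ (delete-kernel (λ l → trans (delete-lincomb cs y l) (cs·y′≋0 l)) k)) (-‿inverseʳ _))

    lift-solution : Solvable (delete ∘ y) reducedᵇ → Solvable y b
    lift-solution (g , g·y′≈b′) = ĝ , λ j → begin
      ⟨ ĝ , y j ⟩                                                  ≈⟨ ⟨⟩-delete ĝ (y j) ⟩
      ⟨ ĝ ∘ punchIn p , delete (y j) ⟩ + coeff (y j) * ⟨ ĝ , y j₀ ⟩
        ≈⟨ +-cong (trans (⟨⟩-congˡ (delete (y j)) (extend-punchIn g (b j₀))) (g·y′≈b′ j))
                  (*-congˡ (⟨extend,x⟩ g (b j₀))) ⟩
      b j - coeff (y j) * b j₀ + coeff (y j) * b j₀                ≈⟨ //-rightDividesˡ _ (b j) ⟩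
      b j                                                          ∎
      where ĝ = extend g (b j₀)

  consistent⇒solvable : ∀ {d m} (y : Fin m → Vec d) b → Consistent y b → Solvable y b
  consistent⇒solvable {zero} y b con = (λ ()) , λ j → sym (consistent-zero (λ _ ()) con j)
  consistent⇒solvable {suc d} y b con with zero-or-nonzero y
  ... | inj₁ y≋0 = 0ᵛ , λ j → trans (⟨⟩-zeroˡ (y j)) (sym (consistent-zero y≋0 con j))
  ... | inj₂ (j₀ , p , y₀ₚ≉0) = lift-solution (consistent⇒solvable (delete ∘ y) reducedᵇ (reduce-consistent con))
    where open Pivot y b j₀ p y₀ₚ≉0

  annihilator : ∀ {s t} (B : Fin t → Vec s) {x} → ¬ InSpan B x → ∀ g →
                ∃ λ g′ → ⟨ g′ , x ⟩ ≈ 0# × (∀ {y} → InSpan B y → ⟨ g′ , y ⟩ ≈ ⟨ g , y ⟩)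
  annihilator B {x} x∉B g with consistent⇒solvable (x ∷ B) (0# ∷ λ l → ⟨ g , B l ⟩) consistent
    where
    consistent : Consistent (x ∷ B) (0# ∷ λ l → ⟨ g , B l ⟩)
    consistent cs cs·w≋0 with cs zero ≟ 0#
    ... | no c₀≉0  = ⊥-elim (x∉B (dependent⇒InSpan (x ∷ B) cs cs·w≋0 c₀≉0))
    ... | yes c₀≈0 = begin
      cs zero * 0# + sum (λ l → cs (suc l) * ⟨ g , B l ⟩) ≈⟨ +-cong (zeroʳ _) (sym (⟨⟩-lincombʳ g (cs ∘ suc) B)) ⟩
      0# + ⟨ g , lincomb (cs ∘ suc) B ⟩                   ≈⟨ +-identityˡ _ ⟩
      ⟨ g , lincomb (cs ∘ suc) B ⟩
        ≈⟨ ⟨⟩-congʳ g (λ k → trans (sym (lincomb-tail x B cs c₀≈0 k)) (cs·w≋0 k)) ⟩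
      ⟨ g , 0ᵛ ⟩                                          ≈⟨ ⟨⟩-zeroʳ g ⟩
      0#                                                  ∎
  ... | g′ , g′·w≈b = g′ , g′·w≈b zero , λ { {y} (cs , cs·B≋y) → begin
    ⟨ g′ , y ⟩                           ≈⟨ ⟨⟩-congʳ g′ (λ k → sym (cs·B≋y k)) ⟩
    ⟨ g′ , lincomb cs B ⟩                ≈⟨ ⟨⟩-lincombʳ g′ cs B ⟩
    sum (λ l → cs l * ⟨ g′ , B l ⟩)      ≈⟨ sum-cong-≋ (λ l → *-congˡ (g′·w≈b (suc l))) ⟩
    sum (λ l → cs l * ⟨ g , B l ⟩)       ≈⟨ ⟨⟩-lincombʳ g cs B ⟨
    ⟨ g , lincomb cs B ⟩                 ≈⟨ ⟨⟩-congʳ g cs·B≋y ⟩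
    ⟨ g , y ⟩                            ∎ }

module FiniteField {c ℓ : Level} (F : Field c ℓ) {q : ℕ} (size : HasSize F q) where
  open Field F hiding (zero)
  open LinAlg F
  open HasSize size
  open import Data.Vec.Functional.Relation.Binary.Equality.Setoid setoid using (_≋_)
  open import Relation.Binary.Reasoning.Setoid setoid

  _≟_ : Decidable _≈_
  x ≟ y with surjective x | surjective y
  ... | i , x≈i | j , y≈j with i Fin.≟ j
  ... | yes ≡.refl = yes (trans x≈i (sym y≈j))
  ... | no i≢j     = no λ x≈y → i≢j (injective i j (trans (sym x≈i) (trans x≈y y≈j)))

  open LinearAlgebra F _≟_

  2≤q : 2 ℕ.≤ q
  2≤q = distinct⇒2≤ λ index₀≡index₁ →
    0≉1 (trans (proj₂ (surjective 0#)) (trans (reflexive (≡.cong enum index₀≡index₁)) (sym (proj₂ (surjective 1#)))))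

  vector : ∀ {s} → Fin (q ℕ.^ s) → Vec s
  vector {s} e = enum ∘ finToFun {q} {s} e

  vector-surjective : ∀ {s} (x : Vec s) → ∃ λ e → vector e ≋ x
  vector-surjective x = funToFin index , λ k →
    trans (reflexive (≡.cong enum (Fin.finToFun-funToFin index k))) (sym (proj₂ (surjective (x k))))
    where
    index = λ k → proj₁ (surjective (x k))

  vector-injective : ∀ {s} {e e′ : Fin (q ℕ.^ s)} → vector {s} e ≋ vector e′ → e ≡ e′
  vector-injective {s} {e} {e′} e≋e′ = ≡.trans (≡.sym (Fin.funToFin-finToFin {s} {q} e))
    (≡.trans (funToFin-cong (λ k → injective _ _ (e≋e′ k))) (Fin.funToFin-finToFin {s} {q} e′))

  uncovered : ∀ {s N} → N ℕ.< q ℕ.^ s → (f : Fin N → Vec s) → ∃ λ x → ∀ a → ¬ (f a ≋ x)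
  uncovered {s} N<q^s f with Fin.all? (λ e → Fin.any? (λ a → f a ≋? vector {s} e))
  ... | no ¬covers with Fin.¬∀⟶∃¬ _ _ (λ e → Fin.any? (λ a → f a ≋? vector {s} e)) ¬covers
  ...   | e , e-missed = vector e , λ a fₐ≋e → e-missed (a , fₐ≋e)
  uncovered {s} N<q^s f | yes covers with Fin.pigeonhole N<q^s (λ e → proj₁ (covers e))
  ...   | i , j , i<j , same = contradiction (vector-injective vᵢ≋vⱼ) (Fin.<⇒≢ i<j)
    where
    vᵢ≋vⱼ : vector {s} i ≋ vector j
    vᵢ≋vⱼ k = trans (sym (proj₂ (covers i) k)) (trans (reflexive (≡.cong (λ a → f a k) same)) (proj₂ (covers j) k))

  InSpan? : ∀ {s r} (B : Fin r → Vec s) x → Dec (InSpan B x)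
  InSpan? B x with Fin.any? (λ e → lincomb (vector e) B ≋? x)
  ... | yes (e , e·B≋x) = yes (vector e , e·B≋x)
  ... | no ∄e           = no λ { (cs , cs·B≋x) →
    let e , e≋cs = vector-surjective cs in ∄e (e , λ k → trans (lincomb-congˡ B e≋cs k) (cs·B≋x k)) }

  avoid-spans : ∀ {n t s} → n ℕ.* q ℕ.^ t ℕ.< q ℕ.^ s → (B : Fin n → Fin t → Vec s) →
                ∃ λ x → ∀ i → ¬ InSpan (B i) x
  avoid-spans {n} {t} n*q^t<q^s B with uncovered n*q^t<q^s (λ a → spanned (Fin.remQuot {n} (q ℕ.^ t) a))
    where
    spanned : Fin n × Fin (q ℕ.^ t) → Vec _
    spanned (i , e) = lincomb (vector e) (B i)
  ... | x , x-missed = x , λ { i (cs , cs·B≋x) →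
    let e , e≋cs = vector-surjective cs
    in x-missed (Fin.combine i e) λ k →
         trans (reflexive (≡.cong (λ (i , e) → lincomb (vector e) (B i) k) (Fin.remQuot-combine i e)))
               (trans (lincomb-congˡ (B i) e≋cs k) (cs·B≋x k)) }

  independent-subfamily : ∀ {s m} (w : Fin m → Vec s) {P : Fin m → Set} → (∀ j → Dec (P j)) →
    ∃₂ λ r (idx : Fin r → Σ (Fin m) P) → LinIndep (w ∘ proj₁ ∘ idx) × (∀ j → P j → InSpan (w ∘ proj₁ ∘ idx) (w j))
  independent-subfamily {m = zero}  w P? = 0 , (λ ()) , (λ _ _ ()) , λ ()
  independent-subfamily {m = suc m} w P? with independent-subfamily (w ∘ suc) (P? ∘ suc)
  ... | r , idx , ind , spans with P? zero | InSpan? (w ∘ suc ∘ proj₁ ∘ idx) (w zero)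
  ...   | yes P₀ | no w₀∉ = suc r , idx′ , LinIndep-∷ ind w₀∉ ,
                            λ { zero _ → InSpan-∈ (w ∘ proj₁ ∘ idx′) zero ; (suc j) Pⱼ → InSpan-∷ _ _ (spans j Pⱼ) }
    where
    idx′ : Fin (suc r) → Σ (Fin (suc m)) _
    idx′ = (zero , P₀) ∷ shift idx
  ...   | yes _  | yes w₀∈ = r , shift idx , ind , λ { zero _ → w₀∈ ; (suc j) → spans j }
  ...   | no ¬P₀ | _       = r , shift idx , ind , λ { zero P₀ → contradiction P₀ ¬P₀ ; (suc j) → spans j }

  DimSpan≤⇒spanned : ∀ {s m t} (w : Fin m → Vec s) {P : Fin m → Set} → (∀ j → Dec (P j)) →
    DimSpan≤ {I = Σ (Fin m) P} (w ∘ proj₁) t → ∃ λ (B : Fin t → Vec s) → ∀ j → P j → InSpan B (w j)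
  DimSpan≤⇒spanned w P? dim≤t with independent-subfamily w P?
  ... | r , idx , ind , spans with InSpan-pad (dim≤t r idx ind) (w ∘ proj₁ ∘ idx)
  ...   | B , ⊆B = B , λ j Pⱼ → ⊆B (spans j Pⱼ)

  gram⇒minrk≤ : ∀ {n s r} (G : Graph n) (g u : Fin n → Vec s) → (∀ i → ⟨ g i , u i ⟩ ≉ 0#) →
                (∀ i j → Graph.Adj (complement G) i j → ⟨ g i , u j ⟩ ≈ 0#) → s ℕ.≤ r → Minrk≤ G r
  gram⇒minrk≤ G g u diag off s≤r =
    (λ i j → ⟨ g i , u j ⟩) , (diag , λ i j i≢j ¬adj → off i j (i≢j , ¬adj)) ,
    λ m idx ind → ℕ.≤-trans (rank-gram≤ g u m idx ind) s≤r

  module Reduction {n} (G : Graph (suc n)) (t : ℕ) where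
    open Graph (complement G) using (Adj; adj?)

    -- The invariant of the reduction: ⟨ g i , u j ⟩ represents G with rank ≤ s, and an
    -- orthogonal representation of the complement is the case g = u.
    record LocalFactorisation (s : ℕ) : Set (c Level.⊔ ℓ) where
      field
        u g       : Fin (suc n) → Vec s
        ⟨gᵢ,uᵢ⟩≉0 : ∀ i → ⟨ g i , u i ⟩ ≉ 0#
        ⟨gᵢ,uⱼ⟩≈0 : ∀ i j → Adj i j → ⟨ g i , u j ⟩ ≈ 0#
        local     : Locality≤ (complement G) u t

    _∈N[_] : Fin (suc n) → Fin (suc n) → Set
    j ∈N[ i ] = (j ≡ i) ⊎ Adj i j

    _∈?N[_] : ∀ j i → Dec (j ∈N[ i ])
    j ∈?N[ i ] = (j Fin.≟ i) ⊎-dec adj? i j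

    LocalFactorisation⇒Minrk≤ : ∀ {s r} → LocalFactorisation s → s ℕ.≤ r → Minrk≤ G r
    LocalFactorisation⇒Minrk≤ Φ = gram⇒minrk≤ G g u ⟨gᵢ,uᵢ⟩≉0 ⟨gᵢ,uⱼ⟩≈0
      where open LocalFactorisation Φ

    shrink : ∀ {s} → suc n ℕ.* q ℕ.^ t ℕ.< q ℕ.^ suc s → LocalFactorisation (suc s) → LocalFactorisation s
    shrink {s} room Φ = record
      { u         = delete ∘ u
      ; g         = λ i → g′ i ∘ punchIn p
      ; ⟨gᵢ,uᵢ⟩≉0 = λ i → ⟨gᵢ,uᵢ⟩≉0 i ∘ trans (sym (preserved i i (inj₁ ≡.refl)))
      ; ⟨gᵢ,uⱼ⟩≈0 = λ i j adj → trans (preserved i j (inj₂ adj)) (⟨gᵢ,uⱼ⟩≈0 i j adj)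
      ; local     = λ v m idx ind → local v m idx (LinIndep-delete (u ∘ proj₁ ∘ idx) ind)
      }
      where
      open LocalFactorisation Φ

      B : Fin (suc n) → Fin t → Vec (suc s)
      B i = proj₁ (DimSpan≤⇒spanned u (_∈?N[ i ]) (local i))

      B-spans : ∀ i j → j ∈N[ i ] → InSpan (B i) (u j)
      B-spans i = proj₂ (DimSpan≤⇒spanned u (_∈?N[ i ]) (local i))

      x : Vec (suc s)
      x = proj₁ (avoid-spans room B)

      x∉B : ∀ i → ¬ InSpan (B i) x
      x∉B = proj₂ (avoid-spans room B)

      -- The one place where a vertex is needed: x ∉ span (B zero) rules out x = 0.
      x≉0 : ¬ (x ≋ 0ᵛ)
      x≉0 = x∉B zero ∘ InSpan-zero (B zero)

      p : Fin (suc s)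
      p = proj₁ (nonzero-coordinate x x≉0)

      xₚ≉0 : x p ≉ 0#
      xₚ≉0 = proj₂ (nonzero-coordinate x x≉0)

      open Deletion x p xₚ≉0

      g′ : Fin (suc n) → Vec (suc s)
      g′ i = proj₁ (annihilator (B i) (x∉B i) (g i))

      g′x≈0 : ∀ i → ⟨ g′ i , x ⟩ ≈ 0#
      g′x≈0 i = proj₁ (proj₂ (annihilator (B i) (x∉B i) (g i)))

      g′≈g : ∀ i {y} → InSpan (B i) y → ⟨ g′ i , y ⟩ ≈ ⟨ g i , y ⟩
      g′≈g i = proj₂ (proj₂ (annihilator (B i) (x∉B i) (g i)))

      preserved : ∀ i j → j ∈N[ i ] → ⟨ g′ i ∘ punchIn p , delete (u j) ⟩ ≈ ⟨ g i , u j ⟩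
      preserved i j j∈Nᵢ = begin
        ⟨ g′ i ∘ punchIn p , delete (u j) ⟩                           ≈⟨ +-identityʳ _ ⟨
        ⟨ g′ i ∘ punchIn p , delete (u j) ⟩ + 0#                      ≈⟨ +-congˡ (trans (*-congˡ (g′x≈0 i)) (zeroʳ _)) ⟨
        ⟨ g′ i ∘ punchIn p , delete (u j) ⟩ + coeff (u j) * ⟨ g′ i , x ⟩ ≈⟨ ⟨⟩-delete (g′ i) (u j) ⟨
        ⟨ g′ i , u j ⟩                                                ≈⟨ g′≈g i (B-spans i j j∈Nᵢ) ⟩
        ⟨ g i , u j ⟩                                                 ∎

    reduce : ∀ {s r} → (∀ {s′} → r ℕ.≤ s′ → suc n ℕ.* q ℕ.^ t ℕ.< q ℕ.^ suc s′) →
             LocalFactorisation s → Minrk≤ G r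
    reduce {zero} room Φ = LocalFactorisation⇒Minrk≤ Φ z≤n
    reduce {suc s} {r} room Φ with suc s ℕ.≤? r
    ... | yes s<r = LocalFactorisation⇒Minrk≤ Φ s<r
    ... | no s≮r = reduce room (shrink (room (ℕ.≤-pred (ℕ.≰⇒> s≮r))) Φ)

open import Data.Nat using (_+_)

theorem6p9 : ∀ {c ℓ : Level} (F : Field c ℓ) (q : ℕ) → HasSize F q →
    ∀ (n : ℕ) (G : Graph n) (t k : ℕ) →
    LinAlg.LocOrthDim≤ F (complement G) t → IsCeilLog q n k →
    LinAlg.Minrk≤ F G (t + k)
theorem6p9 F q size zero G t k _ _ = gram⇒minrk≤ G (λ ()) (λ ()) (λ ()) (λ ()) z≤n
  where open FiniteField F size
theorem6p9 F q size (suc n) G t k (s , u , (u·u≉0 , u⊥u) , local) (n≤q^k , _) =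
  reduce (n*q^t<q^[1+s] {t = t} {k} 2≤q n≤q^k)
         (record { u = u ; g = u ; ⟨gᵢ,uᵢ⟩≉0 = u·u≉0 ; ⟨gᵢ,uⱼ⟩≈0 = u⊥u ; local = local })
  where
  open FiniteField F size
  open Reduction G t
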